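{- For every $\varepsilon>0$ there exists an integer $d_\varepsilon$ such that for all integers $d\ge d_\varepsilon$ and $N\ge 1$, and every point $\mathbf a\in\mathcal W(d,N)$, the proportion of triangles $(\mathbf a,\mathbf v_1,\mathbf v_2)$ with $\mathbf v_1,\mathbf v_2\in\mathcal V(d,N)$ such that $$\bigl|\operatorname{dist}_d(\mathbf a,\mathbf v_1)-\operatorname{dist}_d(\mathbf a,\mathbf v_2)\bigr|\le\varepsilon$$ is at least $1-\varepsilon$.
   Context: For integers $d,N\ge1$, $\mathcal W=\mathcal W(d,N)=\{0,1,\dots,N\}^d$ is the set of lattice points of the hypercube $[0,N]^d$, and $\mathcal V=\mathcal V(d,N)=\{0,N\}^d$ is the set of its $2^d$ vertices. For $\mathbf u,\mathbf v\in\mathbb R^d$ the normalized distance is $\operatorname{dist}_d(\mathbf u,\mathbf v)=\frac{1}{\sqrt d\,N}\bigl(\sum_{j=1}^d(u_j-v_j)^2\bigr)^{1/2}$. Triangles $(\mathbf a,\mathbf v_1,\mathbf v_2)$ are counted as pairs $(\mathbf v_1,\mathbf v_2)\in\mathcal V^2$ forming with $\mathbf a$ a triangle.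
   Formalization: The parameter ε ranges over the positive rationals. -}

module Defs where

open import Data.Bool using (Bool; true; false; if_then_else_)
open import Data.Nat as ℕ using (ℕ; zero; suc; ∣_-_∣)
open import Data.Vec using (Vec; []; _∷_; map; zipWith; foldr)
open import Data.List as List using (List; length; filter; cartesianProduct; _++_)
open import Data.Product using (_×_; _,_; proj₁; proj₂)
open import Data.Sum using (_⊎_)
open import Data.Rational as ℚ using (ℚ; 0ℚ; _≤_; _≤?_; _-_; _*_; _+_)
open import Relation.Nullary using (Dec)
open import Data.Integer using (+_)

ℕtoℚ : ℕ → ℚ
ℕtoℚ n = (+ n) ℚ./ 1
open import Relation.Nullary.Decidable using (_×-dec_; _⊎-dec_)

-- The vertex set 𝒱(d,N) = {0,N}^d, encoded by Bool^d (false ↦ 0, true ↦ N).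
allBoolVecs : (d : ℕ) → List (Vec Bool d)
allBoolVecs zero = [] List.∷ List.[]
allBoolVecs (suc d) =
  List.map (true ∷_) (allBoolVecs d) ++ List.map (false ∷_) (allBoolVecs d)

vertex : {d : ℕ} → ℕ → Vec Bool d → Vec ℕ d
vertex N = map (λ b → if b then N else 0)

sqDist : {d : ℕ} → Vec ℕ d → Vec ℕ d → ℕ
sqDist u v = foldr _ ℕ._+_ 0 (zipWith (λ x y → ∣ x - y ∣ ℕ.* ∣ x - y ∣) u v)

-- For rationals x, y, c ≥ 0:  SqrtClose x y c  ⇔  |√x − √y| ≤ √c.
-- (√x ≤ √y + √c  ⇔  x − y − c ≤ 2√(yc)  ⇔  x−y−c ≤ 0 ∨ (x−y−c)² ≤ 4yc.)
SqrtLe : ℚ → ℚ → ℚ → Set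
SqrtLe x y c = (x - y - c ≤ 0ℚ) ⊎ ((x - y - c) * (x - y - c) ≤ ℕtoℚ 4 * y * c)

sqrtLe? : (x y c : ℚ) → Dec (SqrtLe x y c)
sqrtLe? x y c = (x - y - c ≤? 0ℚ) ⊎-dec ((x - y - c) * (x - y - c) ≤? ℕtoℚ 4 * y * c)

SqrtClose : ℚ → ℚ → ℚ → Set
SqrtClose x y c = SqrtLe x y c × SqrtLe y x c

sqrtClose? : (x y c : ℚ) → Dec (SqrtClose x y c)
sqrtClose? x y c = sqrtLe? x y c ×-dec sqrtLe? y x c

-- |dist_d(a,v₁) − dist_d(a,v₂)| ≤ ε, where dist_d(u,v) = ‖u−v‖/(√d N).
-- Multiplying by √d N > 0:  |√A − √B| ≤ √(ε² d N²), A,B squared distances.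
Close : (ε : ℚ) (d N : ℕ) → Vec ℕ d → Vec Bool d × Vec Bool d → Set
Close ε d N a (v₁ , v₂) =
  SqrtClose (ℕtoℚ (sqDist a (vertex N v₁)))
            (ℕtoℚ (sqDist a (vertex N v₂)))
            (ε * ε * ℕtoℚ d * ℕtoℚ (N ℕ.* N))

close? : (ε : ℚ) (d N : ℕ) (a : Vec ℕ d) (p : Vec Bool d × Vec Bool d) → Dec (Close ε d N a p)
close? ε d N a (v₁ , v₂) =
  sqrtClose? (ℕtoℚ (sqDist a (vertex N v₁)))
             (ℕtoℚ (sqDist a (vertex N v₂)))
             (ε * ε * ℕtoℚ d * ℕtoℚ (N ℕ.* N))

goodCount : (ε : ℚ) (d N : ℕ) → Vec ℕ d → ℕ
goodCount ε d N a =
  length (filter (close? ε d N a) (cartesianProduct (allBoolVecs d) (allBoolVecs d)))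

{-# OPTIONS --safe #-}
module Submission where

-- Let ε = (k+1)/q and write a vertex as v ∈ {0,1}^d. Coordinatewise, 2‖a − v‖² is a constant plus
-- the signed sum T(v) = Σᵢ ±δᵢ with δᵢ = (N − aᵢ)² − aᵢ² and |δᵢ| ≤ N². Over all 2^d vertices the
-- cross terms of T(v)² cancel, so Σᵥ T(v)² = 2^d Σᵢ δᵢ² ≤ 2^d d N⁴, and by Chebyshev all but a
-- fraction q⁴/d of the vertices are typical: q² |T(v)| ≤ d N². The squared distances from a to two
-- typical vertices differ by at most d N²/q² ≤ ε² d N², which already gives
-- |dist(a,v₁) − dist(a,v₂)| ≤ ε. Once d ≥ 2q⁵ at most a fraction 1/(2q) of the vertices is
-- atypical, so typical pairs make up at least (1 − 1/(2q))² ≥ 1 − ε of all pairs.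

open import Defs

-- Sums and counts over lists and over the cube {0,1}^d
module _ where
  open import Level using (Level)
  open import Data.Bool using (Bool; true; false)
  open import Data.Nat using (ℕ; zero; suc; _+_; _*_; _^_; _≤_; z≤n; s≤s)
  open import Data.Nat.Properties
    using (≤-trans; m≤n+m; m≤n⇒m≤1+n; +-mono-≤; +-monoˡ-≤; +-monoʳ-≤; module ≤-Reasoning;
           +-suc; +-identityʳ; *-zeroʳ; *-distribˡ-+; +-commutativeSemigroup)
  open import Algebra.Properties.CommutativeSemigroup +-commutativeSemigroup using (interchange)
  open import Data.Nat.ListAction using (sum)
  open import Data.Nat.ListAction.Properties using (sum-++)
  open import Data.List using (List; []; _∷_; map; length; filter; cartesianProduct; _++_)
  open import Data.List.Properties using (map-++; map-∘; length-++; length-map; filter-++)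
  open import Data.Vec using (Vec; _∷_)
  open import Data.Product using (_×_; _,_)
  open import Relation.Unary using (Pred; Decidable)
  open import Relation.Unary.Properties using (∁?)
  open import Relation.Nullary using (¬_; yes; no; contradiction)
  open import Relation.Binary.PropositionalEquality using (_≡_; refl; sym; trans; cong; cong₂; module ≡-Reasoning)

  private
    variable
      A B : Set
      p r : Level

  infixl 9 _²
  _² : ℕ → ℕ
  n ² = n * n

  sum-map-+ : (f g : A → ℕ) (xs : List A) → sum (map (λ x → f x + g x) xs) ≡ sum (map f xs) + sum (map g xs)
  sum-map-+ f g []       = refl
  sum-map-+ f g (x ∷ xs) = trans (cong (f x + g x +_) (sum-map-+ f g xs)) (interchange (f x) (g x) _ _)

  sum-map-*ˡ : (c : ℕ) (f : A → ℕ) (xs : List A) → sum (map (λ x → c * f x) xs) ≡ c * sum (map f xs)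
  sum-map-*ˡ c f []       = sym (*-zeroʳ c)
  sum-map-*ˡ c f (x ∷ xs) = trans (cong (c * f x +_) (sum-map-*ˡ c f xs)) (sym (*-distribˡ-+ c (f x) _))

  sum-map-const : (c : ℕ) (xs : List A) → sum (map (λ _ → c) xs) ≡ length xs * c
  sum-map-const c []       = refl
  sum-map-const c (x ∷ xs) = cong (c +_) (sum-map-const c xs)

  sum-map-map : (f : B → ℕ) (g : A → B) (xs : List A) → sum (map f (map g xs)) ≡ sum (map (λ x → f (g x)) xs)
  sum-map-map f g xs = cong sum (sym (map-∘ xs))

  markov : {P : Pred A p} (P? : Decidable P) (f : A → ℕ) {K : ℕ} →
           (∀ x → ¬ P x → K ≤ f x) → (xs : List A) → length (filter (∁? P?) xs) * K ≤ sum (map f xs)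
  markov P? f h []       = z≤n
  markov P? f h (x ∷ xs) with P? x
  ... | yes _  = ≤-trans (markov P? f h xs) (m≤n+m _ (f x))
  ... | no ¬px = +-mono-≤ (h x ¬px) (markov P? f h xs)

  length-filter-∁ : {P : Pred A p} (P? : Decidable P) (xs : List A) →
                    length (filter P? xs) + length (filter (∁? P?) xs) ≡ length xs
  length-filter-∁ P? []       = refl
  length-filter-∁ P? (x ∷ xs) with P? x
  ... | yes _ = cong suc (length-filter-∁ P? xs)
  ... | no _  = trans (+-suc _ _) (cong suc (length-filter-∁ P? xs))

  length-filter-cartesianProduct : {P : Pred A p} (P? : Decidable P) {R : Pred (A × A) r} (R? : Decidable R) →
    (∀ {x y} → P x → P y → R (x , y)) → (xs ys : List A) →
    length (filter P? xs) * length (filter P? ys) ≤ length (filter R? (cartesianProduct xs ys))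
  length-filter-cartesianProduct P? R? P²⇒R []       ys = z≤n
  length-filter-cartesianProduct {A = A} {P = P} P? {R} R? P²⇒R (x ∷ xs) ys = begin
    length (filter P? (x ∷ xs)) * #P ys                ≤⟨ first-row ⟩
    length (filter R? row) + #P xs * #P ys
      ≤⟨ +-monoʳ-≤ _ (length-filter-cartesianProduct P? R? P²⇒R xs ys) ⟩
    length (filter R? row) + length (filter R? rest)   ≡⟨ length-++ (filter R? row) ⟨
    length (filter R? row ++ filter R? rest)           ≡⟨ cong length (filter-++ R? row rest) ⟨
    length (filter R? (cartesianProduct (x ∷ xs) ys))  ∎
    where
      open ≤-Reasoning
      #P : List A → ℕ
      #P zs = length (filter P? zs)
      row  = map (x ,_) ys
      rest = cartesianProduct xs ys
      row-bound : P x → (zs : List A) → #P zs ≤ length (filter R? (map (x ,_) zs))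
      row-bound px []       = z≤n
      row-bound px (z ∷ zs) with P? z | R? (x , z)
      ... | yes pz | yes _ = s≤s (row-bound px zs)
      ... | yes pz | no ¬r = contradiction (P²⇒R px pz) ¬r
      ... | no _   | yes _ = m≤n⇒m≤1+n (row-bound px zs)
      ... | no _   | no _  = row-bound px zs
      first-row : length (filter P? (x ∷ xs)) * #P ys ≤ length (filter R? row) + #P xs * #P ys
      first-row with P? x
      ... | yes px = +-monoˡ-≤ _ (row-bound px ys)
      ... | no _   = m≤n+m _ _

  length-allBoolVecs : ∀ d → length (allBoolVecs d) ≡ 2 ^ d
  length-allBoolVecs zero    = refl
  length-allBoolVecs (suc d) = begin
    length (map (true ∷_) L ++ map (false ∷_) L)          ≡⟨ length-++ (map (true ∷_) L) ⟩
    length (map (true ∷_) L) + length (map (false ∷_) L)  ≡⟨ cong₂ _+_ (length-map _ L) (length-map _ L) ⟩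
    length L + length L                                   ≡⟨ cong (λ n → n + n) (length-allBoolVecs d) ⟩
    2 ^ d + 2 ^ d                                         ≡⟨ cong (2 ^ d +_) (+-identityʳ (2 ^ d)) ⟨
    2 ^ suc d                                             ∎
    where open ≡-Reasoning
          L = allBoolVecs d

  sum-allBoolVecs-suc : ∀ d (f : Vec Bool (suc d) → ℕ) →
    sum (map f (allBoolVecs (suc d))) ≡ sum (map (λ v → f (true ∷ v) + f (false ∷ v)) (allBoolVecs d))
  sum-allBoolVecs-suc d f = begin
    sum (map f (map (true ∷_) L ++ map (false ∷_) L))
      ≡⟨ cong sum (map-++ f (map (true ∷_) L) _) ⟩
    sum (map f (map (true ∷_) L) ++ map f (map (false ∷_) L))
      ≡⟨ sum-++ (map f (map (true ∷_) L)) _ ⟩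
    sum (map f (map (true ∷_) L)) + sum (map f (map (false ∷_) L))
      ≡⟨ cong₂ _+_ (sum-map-map f _ L) (sum-map-map f _ L) ⟩
    sum (map (λ v → f (true ∷ v)) L) + sum (map (λ v → f (false ∷ v)) L)
      ≡⟨ sum-map-+ _ _ L ⟨
    sum (map (λ v → f (true ∷ v) + f (false ∷ v)) L)
      ∎
    where open ≡-Reasoning
          L = allBoolVecs d

-- Squared distances to the vertices as signed sums
module _ where
  open import Data.Bool using (Bool; true; false; if_then_else_)
  open import Data.Nat as ℕ using (ℕ)
  import Data.Nat.Properties as ℕ
  open import Data.Integer using (ℤ; +_; -[1+_]; 0ℤ; _+_; _*_; -_; _-_; ∣_∣; _≤_; +≤+; -≤+)
  open import Data.Integer.Properties
    using (pos-+; pos-*; +-injective; abs-*; ∣i-j∣≤∣i∣+∣j∣; [+m]-[+n]≡m⊖n; ∣m⊝n∣≤m⊔n; *-distribˡ-+; *-cancelˡ-≤-pos;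
           ≤-refl; module ≤-Reasoning; +-commutativeSemigroup)
  open import Algebra.Properties.CommutativeSemigroup +-commutativeSemigroup using (interchange)
  open import Data.Integer.Tactic.RingSolver using (solve-∀)
  open import Data.Vec as Vec using (Vec; []; _∷_)
  open import Relation.Binary.PropositionalEquality using (_≡_; refl; sym; trans; cong; cong₂; module ≡-Reasoning)

  corner : ℕ → Bool → ℕ
  corner N b = if b then N else 0

  endpointSqDist : ℕ → ℕ → Bool → ℕ
  endpointSqDist N x b = ℕ.∣ x - corner N b ∣ ²

  endpointSqDist≤N² : ∀ {N x} → x ℕ.≤ N → ∀ b → endpointSqDist N x b ℕ.≤ N ²
  endpointSqDist≤N² {N} {x} x≤N b = ℕ.*-mono-≤ ∣x-corner∣≤N ∣x-corner∣≤N
    where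
      corner≤N : ∀ b → corner N b ℕ.≤ N
      corner≤N true  = ℕ.≤-refl
      corner≤N false = ℕ.z≤n
      ∣x-corner∣≤N : ℕ.∣ x - corner N b ∣ ℕ.≤ N
      ∣x-corner∣≤N = ℕ.≤-trans (ℕ.∣m-n∣≤m⊔n x (corner N b)) (ℕ.⊔-lub x≤N (corner≤N b))

  signed : Bool → ℤ → ℤ
  signed true  z = z
  signed false z = - z

  signedSum : ∀ {d} → Vec ℤ d → Vec Bool d → ℤ
  signedSum []       []      = 0ℤ
  signedSum (z ∷ zs) (b ∷ v) = signed b z + signedSum zs v

  +∣i∣²≡i*i : ∀ i → + ∣ i ∣ ² ≡ i * i
  +∣i∣²≡i*i (+ n)    = pos-* n n
  +∣i∣²≡i*i -[1+ n ] = refl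

  parallelogram : ∀ z t → ∣ z + t ∣ ² ℕ.+ ∣ - z + t ∣ ² ≡ 2 ℕ.* (∣ z ∣ ² ℕ.+ ∣ t ∣ ²)
  parallelogram z t = +-injective (begin
    + (∣ z + t ∣ ² ℕ.+ ∣ - z + t ∣ ²)           ≡⟨ pos-+ (∣ z + t ∣ ²) (∣ - z + t ∣ ²) ⟩
    + ∣ z + t ∣ ² + + ∣ - z + t ∣ ²             ≡⟨ cong₂ _+_ (+∣i∣²≡i*i (z + t)) (+∣i∣²≡i*i (- z + t)) ⟩
    (z + t) * (z + t) + (- z + t) * (- z + t)   ≡⟨ expand z t ⟩
    + 2 * (z * z + t * t)                       ≡⟨ cong (+ 2 *_) (cong₂ _+_ (+∣i∣²≡i*i z) (+∣i∣²≡i*i t)) ⟨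
    + 2 * (+ ∣ z ∣ ² + + ∣ t ∣ ²)               ≡⟨ cong (+ 2 *_) (pos-+ (∣ z ∣ ²) (∣ t ∣ ²)) ⟨
    + 2 * + (∣ z ∣ ² ℕ.+ ∣ t ∣ ²)               ≡⟨ pos-* 2 (∣ z ∣ ² ℕ.+ ∣ t ∣ ²) ⟨
    + (2 ℕ.* (∣ z ∣ ² ℕ.+ ∣ t ∣ ²))             ∎)
    where
      open ≡-Reasoning
      expand : ∀ z t → (z + t) * (z + t) + (- z + t) * (- z + t) ≡ + 2 * (z * z + t * t)
      expand = solve-∀

  gap : (Bool → ℕ) → ℤ
  gap f = + f true - + f false

  ∣gap∣≤ : ∀ {f B} → (∀ b → f b ℕ.≤ B) → ∣ gap f ∣ ℕ.≤ B
  ∣gap∣≤ {f} f≤B rewrite [+m]-[+n]≡m⊖n (f true) (f false) =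
    ℕ.≤-trans (∣m⊝n∣≤m⊔n (f true) (f false)) (ℕ.⊔-lub (f≤B true) (f≤B false))

  double≡sum+signed-gap : ∀ (f : Bool → ℕ) b → + 2 * + f b ≡ + (f false ℕ.+ f true) + signed b (gap f)
  double≡sum+signed-gap f true  =
    trans (upper (+ f false) (+ f true)) (cong (_+ gap f) (sym (pos-+ (f false) (f true))))
    where
      upper : ∀ x y → + 2 * y ≡ (x + y) + (y - x)
      upper = solve-∀
  double≡sum+signed-gap f false =
    trans (lower (+ f false) (+ f true)) (cong (_+ - gap f) (sym (pos-+ (f false) (f true))))
    where
      lower : ∀ x y → + 2 * x ≡ (x + y) + - (y - x)
      lower = solve-∀

  vertexGap : ℕ → ℕ → ℤ
  vertexGap N x = gap (endpointSqDist N x)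

  deviation : ∀ {d} → ℕ → Vec ℕ d → Vec Bool d → ℤ
  deviation N a = signedSum (Vec.map (vertexGap N) a)

  centre : ∀ {d} → ℕ → Vec ℕ d → ℕ
  centre N a = Vec.sum (Vec.map (λ x → endpointSqDist N x false ℕ.+ endpointSqDist N x true) a)

  sqDist-polarisation : ∀ {d} N (a : Vec ℕ d) v →
                        + 2 * + sqDist a (vertex N v) ≡ + centre N a + deviation N a v
  sqDist-polarisation N []      []      = refl
  sqDist-polarisation N (x ∷ a) (b ∷ v) = begin
    + 2 * + (s ℕ.+ S)              ≡⟨ cong (+ 2 *_) (pos-+ s S) ⟩
    + 2 * (+ s + + S)              ≡⟨ *-distribˡ-+ (+ 2) (+ s) (+ S) ⟩
    + 2 * + s + + 2 * + S          ≡⟨ cong₂ _+_ (double≡sum+signed-gap (endpointSqDist N x) b)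
                                                (sqDist-polarisation N a v) ⟩
    (+ c + σ) + (+ C + Δ)          ≡⟨ interchange (+ c) σ (+ C) Δ ⟩
    (+ c + + C) + (σ + Δ)          ≡⟨ cong (_+ (σ + Δ)) (pos-+ c C) ⟨
    + (c ℕ.+ C) + (σ + Δ)          ∎
    where
      open ≡-Reasoning
      s = endpointSqDist N x b
      S = sqDist a (vertex N v)
      c = endpointSqDist N x false ℕ.+ endpointSqDist N x true
      C = centre N a
      σ = signed b (vertexGap N x)
      Δ = deviation N a v

  sqDist-difference : ∀ {d} N (a : Vec ℕ d) u v →
    + 2 * (+ sqDist a (vertex N u) - + sqDist a (vertex N v)) ≡ deviation N a u - deviation N a v
  sqDist-difference N a u v = begin
    + 2 * (+ A - + B)                    ≡⟨ distrib (+ A) (+ B) ⟩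
    + 2 * + A - + 2 * + B                ≡⟨ cong₂ _-_ (sqDist-polarisation N a u) (sqDist-polarisation N a v) ⟩
    (+ C + Δᵤ) - (+ C + Δᵥ)              ≡⟨ cancel (+ C) Δᵤ Δᵥ ⟩
    Δᵤ - Δᵥ                              ∎
    where
      open ≡-Reasoning
      A = sqDist a (vertex N u)
      B = sqDist a (vertex N v)
      C = centre N a
      Δᵤ = deviation N a u
      Δᵥ = deviation N a v
      distrib : ∀ x y → + 2 * (x - y) ≡ + 2 * x - + 2 * y
      distrib = solve-∀
      cancel : ∀ m s t → (m + s) - (m + t) ≡ s - t
      cancel = solve-∀

  half-difference-≤ : ∀ {D s t : ℤ} {Q K : ℕ} → + 2 * D ≡ s - t →
                      Q ℕ.* ∣ s ∣ ℕ.≤ K → Q ℕ.* ∣ t ∣ ℕ.≤ K → + Q * D ≤ + K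
  half-difference-≤ {D} {s} {t} {Q} {K} 2D≡s-t Qs≤K Qt≤K = *-cancelˡ-≤-pos (+ Q * D) (+ K) (+ 2) (begin
    + 2 * (+ Q * D)                  ≡⟨ swap (+ 2) (+ Q) D ⟩
    + Q * (+ 2 * D)                  ≡⟨ cong (+ Q *_) 2D≡s-t ⟩
    + Q * (s - t)                    ≤⟨ i≤+∣i∣ (+ Q * (s - t)) ⟩
    + ∣ + Q * (s - t) ∣              ≡⟨ cong +_ (abs-* (+ Q) (s - t)) ⟩
    + (Q ℕ.* ∣ s - t ∣)              ≤⟨ +≤+ (ℕ.*-monoʳ-≤ Q (∣i-j∣≤∣i∣+∣j∣ s t)) ⟩
    + (Q ℕ.* (∣ s ∣ ℕ.+ ∣ t ∣))      ≡⟨ cong +_ (ℕ.*-distribˡ-+ Q ∣ s ∣ ∣ t ∣) ⟩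
    + (Q ℕ.* ∣ s ∣ ℕ.+ Q ℕ.* ∣ t ∣)  ≤⟨ +≤+ (ℕ.+-mono-≤ Qs≤K Qt≤K) ⟩
    + (K ℕ.+ K)                      ≡⟨ cong (λ n → + (K ℕ.+ n)) (ℕ.+-identityʳ K) ⟨
    + (2 ℕ.* K)                      ≡⟨ pos-* 2 K ⟩
    + 2 * + K                        ∎)
    where
      open ≤-Reasoning
      swap : ∀ x y z → x * (y * z) ≡ y * (x * z)
      swap = solve-∀
      i≤+∣i∣ : ∀ i → i ≤ + ∣ i ∣
      i≤+∣i∣ (+ n)    = ≤-refl
      i≤+∣i∣ -[1+ n ] = -≤+

-- The second moment of a signed sum, and the counting arithmetic
module _ where
  open import Data.Nat using (ℕ; zero; suc; _+_; _*_; _^_; _≤_; NonZero)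
  open import Data.Nat.Properties
    using (≤-refl; *-mono-≤; *-monoˡ-≤; *-monoʳ-≤; +-monoʳ-≤; +-mono-≤; *-distribˡ-+; *-assoc; *-cancelʳ-≤; m*n≢0;
           m≤m+n; module ≤-Reasoning)
  open import Data.Nat.ListAction using (sum)
  open import Data.Nat.Tactic.RingSolver using (solve-∀)
  open import Data.List using (map; length)
  open import Data.List.Properties using (map-cong)
  open import Data.Integer as ℤ using (ℤ; ∣_∣)
  open import Data.Vec as Vec using (Vec; []; _∷_)
  open import Data.Vec.Relation.Unary.All using (All; []; _∷_)
  open import Relation.Binary.PropositionalEquality using (_≡_; refl; trans; cong; cong₂; module ≡-Reasoning)

  sum-∣signedSum∣² : ∀ {d} (z : Vec ℤ d) →
    sum (map (λ v → ∣ signedSum z v ∣ ²) (allBoolVecs d)) ≡ 2 ^ d * Vec.sum (Vec.map (λ zᵢ → ∣ zᵢ ∣ ²) z)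
  sum-∣signedSum∣² []                = refl
  sum-∣signedSum∣² {suc d} (z ∷ zs) = begin
    sum (map (λ v → ∣ signedSum (z ∷ zs) v ∣ ²) (allBoolVecs (suc d)))
      ≡⟨ sum-allBoolVecs-suc d _ ⟩
    sum (map (λ v → ∣ z ℤ.+ T v ∣ ² + ∣ ℤ.- z ℤ.+ T v ∣ ²) L)
      ≡⟨ cong sum (map-cong (λ v → parallelogram z (T v)) L) ⟩
    sum (map (λ v → 2 * (∣ z ∣ ² + ∣ T v ∣ ²)) L)
      ≡⟨ sum-map-*ˡ 2 _ L ⟩
    2 * sum (map (λ v → ∣ z ∣ ² + ∣ T v ∣ ²) L)
      ≡⟨ cong (2 *_) (sum-map-+ _ _ L) ⟩
    2 * (sum (map (λ _ → ∣ z ∣ ²) L) + sum (map (λ v → ∣ T v ∣ ²) L))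
      ≡⟨ cong (2 *_) (cong₂ _+_ (sum-map-const _ L) (sum-∣signedSum∣² zs)) ⟩
    2 * (length L * ∣ z ∣ ² + 2 ^ d * S)
      ≡⟨ cong (λ n → 2 * (n * ∣ z ∣ ² + 2 ^ d * S)) (length-allBoolVecs d) ⟩
    2 * (2 ^ d * ∣ z ∣ ² + 2 ^ d * S)
      ≡⟨ cong (2 *_) (*-distribˡ-+ (2 ^ d) (∣ z ∣ ²) S) ⟨
    2 * (2 ^ d * (∣ z ∣ ² + S))
      ≡⟨ *-assoc 2 (2 ^ d) _ ⟨
    2 ^ suc d * (∣ z ∣ ² + S)
      ∎
    where
      open ≡-Reasoning
      L = allBoolVecs d
      T = signedSum zs
      S = Vec.sum (Vec.map (λ zᵢ → ∣ zᵢ ∣ ²) zs)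

  sum-∣∣²-≤ : ∀ {d B} {z : Vec ℤ d} → All (λ zᵢ → ∣ zᵢ ∣ ≤ B) z → Vec.sum (Vec.map (λ zᵢ → ∣ zᵢ ∣ ²) z) ≤ d * B ²
  sum-∣∣²-≤ []              = ≤-refl
  sum-∣∣²-≤ (zᵢ≤B ∷ zs≤B) = +-mono-≤ (*-mono-≤ zᵢ≤B zᵢ≤B) (sum-∣∣²-≤ zs≤B)

  weighted-≤-cancel : ∀ {b d P} t R W .{{_ : NonZero R}} .{{_ : NonZero W}} →
                      t * R ≤ d → b * (d * W) ≤ R * (P * W) → t * b ≤ P
  weighted-≤-cancel {b} {d} {P} t R W tR≤d bdW≤RPW = *-cancelʳ-≤ (t * b) P (R * W) {{m*n≢0 R W}} (begin
    t * b * (R * W)   ≡⟨ regroupˡ t b R W ⟩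
    b * (t * R) * W   ≤⟨ *-monoˡ-≤ W (*-monoʳ-≤ b tR≤d) ⟩
    b * d * W         ≡⟨ *-assoc b d W ⟩
    b * (d * W)       ≤⟨ bdW≤RPW ⟩
    R * (P * W)       ≡⟨ regroupʳ R P W ⟩
    P * (R * W)       ∎)
    where
      open ≤-Reasoning
      regroupˡ : ∀ t b R W → t * b * (R * W) ≡ b * (t * R) * W
      regroupˡ = solve-∀
      regroupʳ : ∀ R P W → R * (P * W) ≡ P * (R * W)
      regroupʳ = solve-∀

  square-loss : ∀ {c b P} q → c + b ≡ P → 2 * q * b ≤ P → q * P ² ≤ q * c ² + P ²
  square-loss {c} {b} q refl 2qb≤P = begin
    q * (c + b) ²                   ≤⟨ m≤m+n _ (q * b ²) ⟩
    q * (c + b) ² + q * b ²         ≡⟨ expand q c b ⟩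
    q * c ² + 2 * q * b * (c + b)   ≤⟨ +-monoʳ-≤ (q * c ²) (*-monoˡ-≤ (c + b) 2qb≤P) ⟩
    q * c ² + (c + b) ²             ∎
    where
      open ≤-Reasoning
      expand : ∀ q c b → q * ((c + b) * (c + b)) + q * (b * b) ≡ q * (c * c) + 2 * q * b * (c + b)
      expand = solve-∀

  4^n≡[2^n]² : ∀ n → 4 ^ n ≡ (2 ^ n) ²
  4^n≡[2^n]² zero    = refl
  4^n≡[2^n]² (suc n) = trans (cong (4 *_) (4^n≡[2^n]² n)) (regroup (2 ^ n))
    where
      regroup : ∀ x → 4 * (x * x) ≡ (2 * x) * (2 * x)
      regroup = solve-∀

-- Clearing denominators
module _ where
  open import Data.Nat as ℕ using (ℕ; suc)
  import Data.Nat.Properties as ℕ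
  open import Data.Nat.Coprimality using (Coprime; 1-coprimeTo) renaming (sym to coprime-sym)
  open import Data.Integer using (+_; 0ℤ; _+_; _*_; -_; _-_; _≤_; +≤+)
  open import Data.Integer.Properties
    using (pos-+; pos-*; ≤-trans; ≤-reflexive; i≤j⇒i-j≤0; +-monoˡ-≤; +-identityˡ; module ≤-Reasoning)
  open import Data.Integer.Tactic.RingSolver using (solve-∀)
  import Data.Rational as ℚ
  open import Data.Rational using (ℚ; mkℚ; 0ℚ; 1ℚ; toℚᵘ)
  open import Data.Rational.Properties using (normalize-coprime; toℚᵘ-cancel-≤; toℚᵘ-homo-+; toℚᵘ-homo-*; toℚᵘ-homo‿-)
  open import Data.Rational.Unnormalised as ᵘ using (mkℚᵘ; *≤*; _≃_)
  import Data.Rational.Unnormalised.Properties as ᵘ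
  open import Relation.Binary.PropositionalEquality using (_≡_; sym; trans; cong; cong₂; subst; subst₂)

  toℚᵘ-ℕtoℚ : ∀ n → toℚᵘ (ℕtoℚ n) ≃ mkℚᵘ (+ n) 0
  toℚᵘ-ℕtoℚ n = ᵘ.≃-reflexive (cong toℚᵘ (normalize-coprime (coprime-sym (1-coprimeTo n))))

  toℚᵘ-homo-− : ∀ p q → toℚᵘ (p ℚ.- q) ≃ toℚᵘ p ᵘ.- toℚᵘ q
  toℚᵘ-homo-− p q = ᵘ.≃-trans (toℚᵘ-homo-+ p (ℚ.- q)) (ᵘ.+-congʳ (toℚᵘ p) (toℚᵘ-homo‿- q))

  -- After `image` both goals are inequalities between ℚᵘ literals, where ≤ unfolds by definition to
  -- the cross-multiplied integer inequality `cleared`, in the unreduced form that ℚᵘ's _+_ and _*_ produce.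
  module _ (k m : ℕ) .(coprime : Coprime (suc k) (suc m)) where
    private
      ε : ℚ
      ε = mkℚ (+ suc k) m coprime
      q = suc m

    x-y-ε²de≤0 : ∀ x y d e → + (q ℕ.* q) * (+ x - + y) ≤ + (d ℕ.* e) →
                 ℕtoℚ x ℚ.- ℕtoℚ y ℚ.- ε ℚ.* ε ℚ.* ℕtoℚ d ℚ.* ℕtoℚ e ℚ.≤ 0ℚ
    x-y-ε²de≤0 x y d e q²[x-y]≤de = toℚᵘ-cancel-≤ (ᵘ.≤-respˡ-≃ (ᵘ.≃-sym image) (*≤* cleared))
      where
        image : toℚᵘ (ℕtoℚ x ℚ.- ℕtoℚ y ℚ.- ε ℚ.* ε ℚ.* ℕtoℚ d ℚ.* ℕtoℚ e) ≃
                mkℚᵘ (+ x) 0 ᵘ.- mkℚᵘ (+ y) 0 ᵘ.- mkℚᵘ (+ suc k) m ᵘ.* mkℚᵘ (+ suc k) m ᵘ.* mkℚᵘ (+ d) 0 ᵘ.* mkℚᵘ (+ e) 0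
        image = ᵘ.≃-trans (toℚᵘ-homo-− (ℕtoℚ x ℚ.- ℕtoℚ y) (ε ℚ.* ε ℚ.* ℕtoℚ d ℚ.* ℕtoℚ e)) (ᵘ.+-cong
          (ᵘ.≃-trans (toℚᵘ-homo-− (ℕtoℚ x) (ℕtoℚ y)) (ᵘ.+-cong (toℚᵘ-ℕtoℚ x) (ᵘ.-‿cong (toℚᵘ-ℕtoℚ y))))
          (ᵘ.-‿cong (ᵘ.≃-trans (toℚᵘ-homo-* (ε ℚ.* ε ℚ.* ℕtoℚ d) (ℕtoℚ e)) (ᵘ.*-cong
            (ᵘ.≃-trans (toℚᵘ-homo-* (ε ℚ.* ε) (ℕtoℚ d)) (ᵘ.*-cong (toℚᵘ-homo-* ε ε) (toℚᵘ-ℕtoℚ d)))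
            (toℚᵘ-ℕtoℚ e)))))
        u = + (q ℕ.* q ℕ.* 1 ℕ.* 1)
        s = + suc k
        expand : ∀ x y u s d e → ((x * + 1 + - y * + 1) * u + - (s * s * d * e) * + 1) * + 1
                                 ≡ u * (x - y) - s * s * (d * e)
        expand = solve-∀
        u≡q² : u ≡ + (q ℕ.* q)
        u≡q² = cong +_ (trans (ℕ.*-identityʳ (q ℕ.* q ℕ.* 1)) (ℕ.*-identityʳ (q ℕ.* q)))
        de≤s²de : + (d ℕ.* e) ≤ s * s * (+ d * + e)
        de≤s²de = subst (+ (d ℕ.* e) ≤_)
                        (trans (pos-* (suc k ℕ.* suc k) (d ℕ.* e)) (cong₂ _*_ (pos-* (suc k) (suc k)) (pos-* d e)))
                        (+≤+ (ℕ.m≤n*m (d ℕ.* e) (suc k ℕ.* suc k)))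
        cleared : ((+ x * + 1 + - (+ y) * + 1) * u + - (s * s * + d * + e) * + 1) * + 1 ≤ + 0
        cleared = begin
          ((+ x * + 1 + - (+ y) * + 1) * u + - (s * s * + d * + e) * + 1) * + 1
            ≡⟨ expand (+ x) (+ y) u s (+ d) (+ e) ⟩
          u * (+ x - + y) - s * s * (+ d * + e)
            ≤⟨ i≤j⇒i-j≤0 (≤-trans (subst (λ v → v * (+ x - + y) ≤ + (d ℕ.* e)) (sym u≡q²) q²[x-y]≤de) de≤s²de) ⟩
          + 0
            ∎
          where open ≤-Reasoning

    [1-ε]p≤g : ∀ p g → q ℕ.* p ℕ.≤ q ℕ.* g ℕ.+ p → (1ℚ ℚ.- ε) ℚ.* ℕtoℚ p ℚ.≤ ℕtoℚ g
    [1-ε]p≤g p g qp≤qg+p =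
      toℚᵘ-cancel-≤ (ᵘ.≤-respʳ-≃ (ᵘ.≃-sym (toℚᵘ-ℕtoℚ g)) (ᵘ.≤-respˡ-≃ (ᵘ.≃-sym image) (*≤* cleared)))
      where
        image : toℚᵘ ((1ℚ ℚ.- ε) ℚ.* ℕtoℚ p) ≃ (mkℚᵘ (+ 1) 0 ᵘ.- mkℚᵘ (+ suc k) m) ᵘ.* mkℚᵘ (+ p) 0
        image = ᵘ.≃-trans (toℚᵘ-homo-* (1ℚ ℚ.- ε) (ℕtoℚ p)) (ᵘ.*-cong (toℚᵘ-homo-− 1ℚ ε) (toℚᵘ-ℕtoℚ p))
        s = + suc k
        expand : ∀ q s p g → (+ 1 * q + - s * + 1) * p * + 1 ≡ (q * p - (q * g + s * p)) + g * q
        expand = solve-∀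
        qp≤qg+sp : + q * + p ≤ + q * + g + s * + p
        qp≤qg+sp = subst₂ _≤_ (pos-* q p)
                              (trans (pos-+ (q ℕ.* g) (suc k ℕ.* p)) (cong₂ _+_ (pos-* q g) (pos-* (suc k) p)))
                              (+≤+ (ℕ.≤-trans qp≤qg+p (ℕ.+-monoʳ-≤ (q ℕ.* g) (ℕ.m≤n*m p (suc k)))))
        cleared : (+ 1 * + q + - s * + 1) * + p * + 1 ≤ + g * + (1 ℕ.* q ℕ.* 1)
        cleared = begin
          (+ 1 * + q + - s * + 1) * + p * + 1               ≡⟨ expand (+ q) s (+ p) (+ g) ⟩
          (+ q * + p - (+ q * + g + s * + p)) + + g * + q   ≤⟨ +-monoˡ-≤ (+ g * + q) (i≤j⇒i-j≤0 qp≤qg+sp) ⟩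
          0ℤ + + g * + q                                    ≡⟨ +-identityˡ (+ g * + q) ⟩
          + g * + q                                         ≡⟨ cong (λ n → + g * + n) q≡1*q*1 ⟩
          + g * + (1 ℕ.* q ℕ.* 1)                           ∎
          where
            open ≤-Reasoning
            q≡1*q*1 : q ≡ 1 ℕ.* q ℕ.* 1
            q≡1*q*1 = sym (trans (ℕ.*-identityʳ (1 ℕ.* q)) (ℕ.*-identityˡ q))

-- Typical vertices
module _ where
  open import Level using (0ℓ)
  open import Data.Bool using (Bool)
  open import Data.Nat using (ℕ; zero; suc; _+_; _*_; _^_; _≤_; _≤?_)
  open import Data.Nat.Properties
    using (≤-reflexive; *-mono-≤; *-monoʳ-≤; +-mono-≤; <⇒≤; ≰⇒>; [m*n]*[o*p]≡[m*o]*[n*p]; module ≤-Reasoning)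
  open import Data.Nat.Tactic.RingSolver using (solve-∀)
  open import Data.Nat.ListAction using (sum)
  open import Data.Nat.Coprimality using (Coprime)
  open import Data.Integer as ℤ using (+_; ∣_∣)
  import Data.Rational as ℚ
  open import Data.Rational using (mkℚ)
  open import Data.List using (map; length; filter)
  open import Data.Vec as Vec using (Vec)
  open import Data.Vec.Relation.Unary.All as All using (All)
  open import Data.Vec.Relation.Unary.All.Properties using (map⁺)
  open import Data.Product using (_,_)
  open import Data.Sum using (inj₁)
  open import Relation.Unary using (Pred; Decidable)
  open import Relation.Unary.Properties using (∁?)
  open import Relation.Nullary using (¬_)
  open import Relation.Binary.PropositionalEquality using (_≡_; sym; trans; cong; subst)

  module _ {d : ℕ} (Q N : ℕ) (a : Vec ℕ d) where
    Typical : Pred (Vec Bool d) 0ℓ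
    Typical v = Q * ∣ deviation N a v ∣ ≤ d * N ²

    typical? : Decidable Typical
    typical? v = Q * ∣ deviation N a v ∣ ≤? d * N ²

    typical-sqDist : ∀ {u v} → Typical u → Typical v →
                     + Q ℤ.* (+ sqDist a (vertex N u) ℤ.- + sqDist a (vertex N v)) ℤ.≤ + (d * N ²)
    typical-sqDist {u} {v} =
      half-difference-≤ {s = deviation N a u} {t = deviation N a v} {Q = Q} (sqDist-difference N a u v)

    atypical-count : All (_≤ N) a →
      length (filter (∁? typical?) (allBoolVecs d)) * (d * (d * N ² ²)) ≤ Q ² * (2 ^ d * (d * N ² ²))
    atypical-count a≤N = begin
      #atypical * (d * (d * N ² ²))             ≡⟨ cong (#atypical *_) (square-product d (N ²)) ⟩
      #atypical * (d * N ²) ²                   ≤⟨ markov typical? (λ v → Q ² * ∣ T v ∣ ²) atypical-large L ⟩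
      sum (map (λ v → Q ² * ∣ T v ∣ ²) L)       ≡⟨ sum-map-*ˡ (Q ²) (λ v → ∣ T v ∣ ²) L ⟩
      Q ² * sum (map (λ v → ∣ T v ∣ ²) L)       ≡⟨ cong (Q ² *_) (sum-∣signedSum∣² gaps) ⟩
      Q ² * (2 ^ d * Vec.sum (Vec.map (λ z → ∣ z ∣ ²) gaps))
        ≤⟨ *-monoʳ-≤ (Q ²) (*-monoʳ-≤ (2 ^ d) (sum-∣∣²-≤ gaps≤N²)) ⟩
      Q ² * (2 ^ d * (d * N ² ²))               ∎
      where
        open ≤-Reasoning
        L = allBoolVecs d
        T = deviation N a
        gaps = Vec.map (vertexGap N) a
        #atypical = length (filter (∁? typical?) L)
        square-product : ∀ x y → x * (x * (y * y)) ≡ (x * y) * (x * y)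
        square-product = solve-∀
        atypical-large : ∀ v → ¬ Typical v → (d * N ²) ² ≤ Q ² * ∣ T v ∣ ²
        atypical-large v ¬typical = subst ((d * N ²) ² ≤_) ([m*n]*[o*p]≡[m*o]*[n*p] Q (∣ T v ∣) Q (∣ T v ∣))
                                          (*-mono-≤ dN²≤Q∣T∣ dN²≤Q∣T∣)
          where dN²≤Q∣T∣ = <⇒≤ (≰⇒> ¬typical)
        gaps≤N² : All (λ z → ∣ z ∣ ≤ N ²) gaps
        gaps≤N² = map⁺ (All.map (λ x≤N → ∣gap∣≤ (endpointSqDist≤N² x≤N)) a≤N)

  goodCount-lower-bound : ∀ k m .(c : Coprime (suc k) (suc m)) d N → 2 * suc m * suc m ² ² ≤ d → 1 ≤ N →
    (a : Vec ℕ d) → All (_≤ N) a →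
    (ℚ.1ℚ ℚ.- mkℚ (+ suc k) m c) ℚ.* ℕtoℚ (4 ^ d) ℚ.≤ ℕtoℚ (goodCount (mkℚ (+ suc k) m c) d N a)
  -- Matching d and N on suc lets instance search see that the weights in weighted-≤-cancel are nonzero.
  goodCount-lower-bound k m c zero        N           () _  _ _
  goodCount-lower-bound k m c d           zero        _  () _ _
  goodCount-lower-bound k m c d@(suc _) N@(suc _) d≥ _  a a≤N =
    [1-ε]p≤g k m c (4 ^ d) (goodCount ε d N a) (begin
      q * 4 ^ d                       ≡⟨ cong (q *_) (4^n≡[2^n]² d) ⟩
      q * (2 ^ d) ²                   ≤⟨ square-loss q partition few-atypical ⟩
      q * #typical ² + (2 ^ d) ²      ≤⟨ +-mono-≤ (*-monoʳ-≤ q typical-pairs) (≤-reflexive (sym (4^n≡[2^n]² d))) ⟩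
      q * goodCount ε d N a + 4 ^ d   ∎)
    where
      open ≤-Reasoning
      q = suc m
      ε = mkℚ (+ suc k) m c
      L = allBoolVecs d
      typ? = typical? (q ²) N a
      #typical = length (filter typ? L)
      #atypical = length (filter (∁? typ?) L)
      partition : #typical + #atypical ≡ 2 ^ d
      partition = trans (length-filter-∁ typ? L) (length-allBoolVecs d)
      few-atypical : 2 * q * #atypical ≤ 2 ^ d
      few-atypical = weighted-≤-cancel (2 * q) (q ² ²) (d * N ² ²) d≥ (atypical-count (q ²) N a a≤N)
      -- x − y ≤ c gives the first disjunct of SqrtLe, since √x ≤ √(y + c) ≤ √y + √c.
      close : ∀ {u v} → Typical (q ²) N a u → Typical (q ²) N a v → Close ε d N a (u , v)
      close {u} {v} tu tv = inj₁ (x-y-ε²de≤0 k m c (A u) (A v) d (N ²) (typical-sqDist (q ²) N a tu tv)) ,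
                            inj₁ (x-y-ε²de≤0 k m c (A v) (A u) d (N ²) (typical-sqDist (q ²) N a tv tu))
        where A = λ w → sqDist a (vertex N w)
      typical-pairs : #typical ² ≤ goodCount ε d N a
      typical-pairs = length-filter-cartesianProduct typ? (close? ε d N a) close L L

open import Data.Nat using (ℕ; _^_)
open import Data.Vec using (Vec)
open import Data.Vec.Relation.Unary.All using (All)
open import Data.Product using (∃-syntax; _,_)
open import Data.Rational using (ℚ; 0ℚ; 1ℚ; _<_; _≤_; _-_; _*_; mkℚ; *<*)
open import Data.Integer using (+_; -[1+_]; +<+)
import Data.Nat as ℕ

theorem1p1 : (ε : ℚ) → 0ℚ < ε →
    ∃[ dε ] ((d N : ℕ) → dε ℕ.≤ d → 1 ℕ.≤ N →
      (a : Vec ℕ d) → All (ℕ._≤ N) a →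
      (1ℚ - ε) * ℕtoℚ (4 ^ d) ≤ ℕtoℚ (goodCount ε d N a))
theorem1p1 (mkℚ (+ 0)     m c) (*<* (+<+ ()))
theorem1p1 (mkℚ -[1+ k ]  m c) (*<* ())
theorem1p1 (mkℚ (+ ℕ.suc k) m c) _ = 2 ℕ.* ℕ.suc m ℕ.* ℕ.suc m ² ² , goodCount-lower-bound k m c
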